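{- Let $L:\mathcal U$ be a $\mathcal V$-sup-lattice with basis $\beta:B\to L$. Every bounded generator $\phi:\mathcal P_{\mathcal U\sqcup\mathcal V^+}(B\times L)$ is local, i.e. for every $a:L$ the type $S_{\phi,a}:=\sum_{b:B}\exists a':L,\ (b,a')\in\phi\wedge a'\le a$ is $\mathcal V$-small.
   Context: We work in Martin-Löf type theory with non-cumulative universes (successor $\mathcal V^+$, join $\sqcup$), function extensionality, propositional extensionality and propositional truncations ($\exists$); no propositional resizing. A type is $\mathcal V$-small if equivalent to a type in $\mathcal V$. $\mathcal P_{\mathcal T}(X):=X\to\Omega_{\mathcal T}$ (propositions in $\mathcal T$). A poset: type $P:\mathcal U$ with proposition-valued reflexive antisymmetric transitive $\le:P\to P\to\mathcal W$. A $\mathcal V$-sup-lattice: poset $L:\mathcal U$ where every family indexed by a type in $\mathcal V$ has a join. A basis: $B:\mathcal V$, $\beta:B\to L$ with (1) each $\beta(b)\le x$ $\mathcal V$-small, (2) each $x$ is the join of $\beta\circ\mathrm{pr}_1$ on $\downarrow^B x:=\sum_b\beta(b)\le x$. A generator is $\phi:\mathcal P_{\mathcal U\sqcup\mathcal V^+}(B\times L)$. It is bounded if (i) for all $b:B$, $a:L$ the type $(b,a)\in\phi$ is $\mathcal V$-small, and (ii) there are $I:\mathcal V$ and $\alpha:I\to\mathcal V$ such that for all $a:L$, $b:B$ with $(b,a)\in\phi$ there merely exist $i:I$ and a surjection $\alpha(i)\twoheadrightarrow\downarrow^B a$. -}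

module Defs where

open import Level using (Level; _⊔_; suc; Setω)
open import Data.Product using (Σ; _×_; _,_; proj₁; proj₂; Σ-syntax)
open import Relation.Binary.PropositionalEquality using (_≡_)
open import Function using (_∘_; id)

is-prop : ∀ {i} → Set i → Set i
is-prop X = (x y : X) → x ≡ y

Ω : (𝓣 : Level) → Set (suc 𝓣)
Ω 𝓣 = Σ (Set 𝓣) is-prop

is-equiv : ∀ {i j} {X : Set i} {Y : Set j} → (X → Y) → Set (i ⊔ j)
is-equiv {X = X} {Y} f =
  (Σ (Y → X) λ s → (y : Y) → f (s y) ≡ y) × (Σ (Y → X) λ r → (x : X) → r (f x) ≡ x)

_≃_ : ∀ {i j} → Set i → Set j → Set (i ⊔ j)
X ≃ Y = Σ (X → Y) is-equiv

is-small : ∀ {i} (𝓥 : Level) → Set i → Set (suc 𝓥 ⊔ i)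
is-small 𝓥 X = Σ (Set 𝓥) λ Y → Y ≃ X

FunExt : Setω
FunExt = ∀ {i j} {A : Set i} {B : A → Set j} {f g : (x : A) → B x}
       → ((x : A) → f x ≡ g x) → f ≡ g

PropExt : Setω
PropExt = ∀ {i} {P Q : Set i} → is-prop P → is-prop Q → (P → Q) → (Q → P) → P ≡ Q

record PropTrunc : Setω where
  field
    ∥_∥        : ∀ {i} → Set i → Set i
    ∣_∣        : ∀ {i} {X : Set i} → X → ∥ X ∥
    ∥∥-is-prop : ∀ {i} {X : Set i} → is-prop ∥ X ∥
    ∥∥-rec     : ∀ {i j} {X : Set i} {P : Set j} → is-prop P → (X → P) → ∥ X ∥ → P

  ∃ : ∀ {i j} {X : Set i} → (X → Set j) → Set (i ⊔ j)
  ∃ {X = X} P = ∥ Σ X P ∥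

  is-surjection : ∀ {i j} {X : Set i} {Y : Set j} → (X → Y) → Set (i ⊔ j)
  is-surjection {X = X} {Y} f = (y : Y) → ∃ λ (x : X) → f x ≡ y

record Poset (𝓤 𝓦 : Level) : Set (suc (𝓤 ⊔ 𝓦)) where
  field
    Carrier      : Set 𝓤
    _≤_          : Carrier → Carrier → Set 𝓦
    ≤-is-prop    : (x y : Carrier) → is-prop (x ≤ y)
    ≤-refl       : (x : Carrier) → x ≤ x
    ≤-antisym    : (x y : Carrier) → x ≤ y → y ≤ x → x ≡ y
    ≤-trans      : (x y z : Carrier) → x ≤ y → y ≤ z → x ≤ z

  is-lub : ∀ {k} {I : Set k} → (I → Carrier) → Carrier → Set (𝓤 ⊔ 𝓦 ⊔ k)
  is-lub {I = I} f x = ((i : I) → f i ≤ x)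
                     × ((y : Carrier) → ((i : I) → f i ≤ y) → x ≤ y)

record SupLattice (𝓥 𝓤 𝓦 : Level) : Set (suc (𝓥 ⊔ 𝓤 ⊔ 𝓦)) where
  field
    poset : Poset 𝓤 𝓦
  open Poset poset public
  field
    ⋁      : {I : Set 𝓥} → (I → Carrier) → Carrier
    ⋁-is-lub : {I : Set 𝓥} (f : I → Carrier) → is-lub f (⋁ f)

module _ {𝓥 𝓤 𝓦 : Level} (L : SupLattice 𝓥 𝓤 𝓦) where
  open SupLattice L

  ↓ᴮ : {B : Set 𝓥} → (B → Carrier) → Carrier → Set (𝓥 ⊔ 𝓦)
  ↓ᴮ {B} β x = Σ B λ b → β b ≤ x

  record Basis : Set (suc 𝓥 ⊔ 𝓤 ⊔ 𝓦) where
    field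
      B        : Set 𝓥
      β        : B → Carrier
      ≤-small  : (b : B) (x : Carrier) → is-small 𝓥 (β b ≤ x)
      ↓-join   : (x : Carrier) → is-lub (β ∘ proj₁ {B = λ b → β b ≤ x}) x

  module _ (pt : PropTrunc) (basis : Basis) where
    open PropTrunc pt
    open Basis basis

    Generator : Set (suc (𝓤 ⊔ suc 𝓥))
    Generator = B × Carrier → Ω (𝓤 ⊔ suc 𝓥)

    _∈_ : B × Carrier → Generator → Set (𝓤 ⊔ suc 𝓥)
    p ∈ φ = proj₁ (φ p)

    is-bounded : Generator → Set (suc 𝓥 ⊔ 𝓤 ⊔ 𝓦)
    is-bounded φ =
        ((b : B) (a : Carrier) → is-small 𝓥 ((b , a) ∈ φ))
      × (Σ (Set 𝓥) λ I → Σ (I → Set 𝓥) λ α →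
          (a : Carrier) (b : B) → (b , a) ∈ φ →
            ∃ λ (i : I) → Σ (α i → ↓ᴮ β a) is-surjection)

    S : Generator → Carrier → Set (𝓤 ⊔ suc 𝓥 ⊔ 𝓦)
    S φ a = Σ B λ b → ∃ λ (a' : Carrier) → ((b , a') ∈ φ) × (a' ≤ a)

    is-local : Generator → Set (suc 𝓥 ⊔ 𝓤 ⊔ 𝓦)
    is-local φ = (a : Carrier) → is-small 𝓥 (S φ a)

-- Every a' ≤ a that occurs in φ is the join of the basic elements below it, and by
-- boundedness that family is indexed, up to surjection, by some α i. Hence "∃ a' ≤ a with
-- (b , a') ∈ φ" is equivalent to "φ contains (b , ⋁ m) for some m : α i → ↓ᴮ a", which
-- quantifies only over 𝓥-small types once ↓ᴮ a and membership in φ are replaced by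
-- their small copies.
module Submission where

open import Level using (Level; _⊔_; suc)
open import Defs
open import Data.Product using (Σ; _×_; _,_; proj₁; proj₂)
open import Relation.Binary.PropositionalEquality using (_≡_; sym; cong; subst)
open import Function using (_∘_)

Σ-is-small-by-fibrewise-⇔ : ∀ {𝓥 i} {B : Set 𝓥} (P : B → Set i) (Q : B → Set 𝓥)
  → ((b : B) → is-prop (P b)) → ((b : B) → is-prop (Q b))
  → ((b : B) → P b → Q b) → ((b : B) → Q b → P b) → is-small 𝓥 (Σ B P)
Σ-is-small-by-fibrewise-⇔ {B = B} P Q P-prop Q-prop to from =
  Σ B Q , Q→P , (P→Q , λ { (b , p) → cong (b ,_) (P-prop b _ _) })
              , (P→Q , λ { (b , q) → cong (b ,_) (Q-prop b _ _) })
  where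
  Q→P : Σ B Q → Σ B P
  Q→P (b , q) = b , from b q
  P→Q : Σ B P → Σ B Q
  P→Q (b , p) = b , to b p

module _ (pt : PropTrunc) {𝓥 𝓤 𝓦 : Level} (L : SupLattice 𝓥 𝓤 𝓦) (basis : Basis L) where
  open PropTrunc pt
  open SupLattice L
  open Basis basis

  ↓ᴮₛ : Carrier → Set 𝓥
  ↓ᴮₛ x = Σ B λ b → proj₁ (≤-small b x)

  ↓ᴮₛ→↓ᴮ : {x : Carrier} → ↓ᴮₛ x → ↓ᴮ L β x
  ↓ᴮₛ→↓ᴮ {x} (b , p) = b , proj₁ (proj₂ (≤-small b x)) p

  ↓ᴮ→↓ᴮₛ : {x : Carrier} → ↓ᴮ L β x → ↓ᴮₛ x
  ↓ᴮ→↓ᴮₛ {x} (b , p) = b , proj₁ (proj₁ (proj₂ (proj₂ (≤-small b x)))) p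

  ↓ᴮ-mono : {x y : Carrier} → x ≤ y → ↓ᴮ L β x → ↓ᴮ L β y
  ↓ᴮ-mono {x} {y} x≤y (b , p) = b , ≤-trans (β b) x y p x≤y

  ⋁ᴮ : {J : Set 𝓥} {x : Carrier} → (J → ↓ᴮₛ x) → Carrier
  ⋁ᴮ m = ⋁ (β ∘ proj₁ ∘ m)

  ⋁ᴮ-≤ : {J : Set 𝓥} {x : Carrier} (m : J → ↓ᴮₛ x) → ⋁ᴮ m ≤ x
  ⋁ᴮ-≤ {x = x} m = proj₂ (⋁-is-lub (β ∘ proj₁ ∘ m)) x (proj₂ ∘ ↓ᴮₛ→↓ᴮ ∘ m)

  ⋁-surjection-onto-↓ᴮ : {J : Set 𝓥} {x : Carrier} (s : J → ↓ᴮ L β x)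
    → is-surjection s → ⋁ (β ∘ proj₁ ∘ s) ≡ x
  ⋁-surjection-onto-↓ᴮ {J} {x} s s-surj = ≤-antisym _ _ ⋁≤x x≤⋁
    where
    f : J → Carrier
    f = β ∘ proj₁ ∘ s
    ⋁≤x : ⋁ f ≤ x
    ⋁≤x = proj₂ (⋁-is-lub f) x (proj₂ ∘ s)
    x≤⋁ : x ≤ ⋁ f
    x≤⋁ = proj₂ (↓-join x) (⋁ f) λ c →
      ∥∥-rec (≤-is-prop _ _)
        (λ { (j , sj≡c) → subst (λ d → β (proj₁ d) ≤ ⋁ f) sj≡c (proj₁ (⋁-is-lub f) j) })
        (s-surj c)

  module _ (φ : Generator L pt basis) (bounded : is-bounded L pt basis φ) where

    _∈φ : B × Carrier → Set (𝓤 ⊔ suc 𝓥)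
    p ∈φ = _∈_ L pt basis p φ

    _∈φₛ : B × Carrier → Set 𝓥
    (b , x) ∈φₛ = proj₁ (proj₁ bounded b x)

    ∈φₛ→∈φ : {b : B} {x : Carrier} → (b , x) ∈φₛ → (b , x) ∈φ
    ∈φₛ→∈φ {b} {x} = proj₁ (proj₂ (proj₁ bounded b x))

    ∈φ→∈φₛ : {b : B} {x : Carrier} → (b , x) ∈φ → (b , x) ∈φₛ
    ∈φ→∈φₛ {b} {x} = proj₁ (proj₁ (proj₂ (proj₂ (proj₁ bounded b x))))

    I : Set 𝓥
    I = proj₁ (proj₂ bounded)

    α : I → Set 𝓥
    α = proj₁ (proj₂ (proj₂ bounded))

    α-covers-↓ᴮ : (x : Carrier) (b : B) → (b , x) ∈φ
      → ∃ λ (i : I) → Σ (α i → ↓ᴮ L β x) is-surjection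
    α-covers-↓ᴮ = proj₂ (proj₂ (proj₂ bounded))

    S-fibre : Carrier → B → Set (𝓤 ⊔ suc 𝓥 ⊔ 𝓦)
    S-fibre a b = ∃ λ (a' : Carrier) → ((b , a') ∈φ) × (a' ≤ a)

    S-fibreₛ : Carrier → B → Set 𝓥
    S-fibreₛ a b = ∃ λ (i : I) → Σ (α i → ↓ᴮₛ a) λ m → (b , ⋁ᴮ m) ∈φₛ

    S-fibre→S-fibreₛ : (a : Carrier) (b : B) → S-fibre a b → S-fibreₛ a b
    S-fibre→S-fibreₛ a b = ∥∥-rec ∥∥-is-prop λ { (a' , b,a'∈φ , a'≤a) →
      ∥∥-rec ∥∥-is-prop
        (λ { (i , s , s-surj) →
          let m : α i → ↓ᴮₛ a
              m = ↓ᴮ→↓ᴮₛ ∘ ↓ᴮ-mono a'≤a ∘ s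
          -- ⋁ᴮ m is definitionally ⋁ (β ∘ proj₁ ∘ s), the join of the surjection onto ↓ᴮ a'.
          in ∣ i , m , ∈φ→∈φₛ (subst (λ x → (b , x) ∈φ)
                                   (sym (⋁-surjection-onto-↓ᴮ s s-surj)) b,a'∈φ) ∣ })
        (α-covers-↓ᴮ a' b b,a'∈φ) }

    S-fibreₛ→S-fibre : (a : Carrier) (b : B) → S-fibreₛ a b → S-fibre a b
    S-fibreₛ→S-fibre a b = ∥∥-rec ∥∥-is-prop λ { (i , m , b,⋁m∈φ) →
      ∣ ⋁ᴮ m , ∈φₛ→∈φ b,⋁m∈φ , ⋁ᴮ-≤ m ∣ }

    bounded-generator-is-local : is-local L pt basis φ
    bounded-generator-is-local a =
      Σ-is-small-by-fibrewise-⇔ (S-fibre a) (S-fibreₛ a) (λ _ → ∥∥-is-prop) (λ _ → ∥∥-is-prop)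
        (S-fibre→S-fibreₛ a) (S-fibreₛ→S-fibre a)

proposition8p6 : FunExt → PropExt → (pt : PropTrunc)
    → {𝓥 𝓤 𝓦 : Level} (L : SupLattice 𝓥 𝓤 𝓦) (basis : Basis L)
    → (φ : Generator L pt basis) → is-bounded L pt basis φ → is-local L pt basis φ
proposition8p6 _ _ pt L basis = bounded-generator-is-local pt L basis
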